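{- Let $\lambda$ be any shape and $S$ its set of segments. Then (1) $\mathrm{Bic}(S)$ is ordered by single-step inclusion; (2) $W\cup\overline{(X\cup Y)\setminus W}$ is biclosed for all $W,X,Y\in\mathrm{Bic}(S)$ with $W\subseteq X\cap Y$; and (3) if $s,t,u\in S$ with $s\circ t=u$, then $s\subsetneq u$ and $t\subsetneq u$.
   Context: A shape is a finite induced subgraph $\lambda$ of the square grid graph on $\mathbb{Z}\times\mathbb{Z}$; North means increasing second coordinate, East increasing first coordinate. A vertex $v$ of $\lambda$ is interior if all nine points $v+(a,b)$, $a,b\in\{ -1,0,1\}$, are vertices of $\lambda$. A segment of $\lambda$ is a sequence $u_0,\dots,u_m$ ($m\ge0$) of interior vertices with each $u_i$ one step South or East of $u_{i-1}$; $s_{\mathrm{init}}=u_0$, $s_{\mathrm{term}}=u_m$; $s\subseteq t$ means $s$ is a contiguous subsequence of $t$. Segments $s,t$ are composable if $s_{\mathrm{term}}$ is one unit North or West of $t_{\mathrm{init}}$, and then $s\circ t$ is the concatenated segment. The closure $\overline{X}$ of a set $X\subseteq S$ is the smallest set containing $X$ such that $s,t\in\overline{X}$ composable implies $s\circ t\in\overline{X}$. $X$ is closed if $\overline{X}=X$, biclosed if $X$ and $S\setminus X$ are closed; $\mathrm{Bic}(S)$ is the poset of biclosed sets ordered by inclusion. A collection $\mathcal{B}$ of subsets of $S$ is ordered by single-step inclusion if for all $X,Y\in\mathcal{B}$ with $X\subsetneq Y$ there is $y\in Y\setminus X$ with $X\cup\{y\}\in\mathcal{B}$. -}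

module Defs where

open import Data.Integer using (ℤ; _+_; -_; +_; 0ℤ; 1ℤ)
open import Data.Product using (_×_; _,_; Σ; ∃; ∃-syntax)
open import Data.Sum using (_⊎_)
open import Data.List using (List; []; _∷_; _++_)
open import Data.List.Membership.Propositional using (_∈_)
open import Data.Bool using (Bool; T)
open import Relation.Nullary using (¬_)
open import Relation.Binary.PropositionalEquality using (_≡_; _≢_)

-- Points of the grid ℤ × ℤ (first coordinate: East, second: North).
Point : Set
Point = ℤ × ℤ

-- A shape: a finite induced subgraph of the grid, determined by its
-- (finite) vertex set, given as a list of points.
Shape : Set
Shape = List Point

_⊕_ : Point → Point → Point
(a , b) ⊕ (c , d) = (a + c , b + d)

north south east west : Point
north = (0ℤ , 1ℤ)
south = (0ℤ , - 1ℤ)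
east  = (1ℤ , 0ℤ)
west  = (- 1ℤ , 0ℤ)

offsets : List ℤ
offsets = - 1ℤ ∷ 0ℤ ∷ 1ℤ ∷ []

Interior : Shape → Point → Set
Interior sh v = ∀ a b → a ∈ offsets → b ∈ offsets → (v ⊕ (a , b)) ∈ sh

Seg : Set
Seg = List Point

data Steps : Seg → Set where
  one  : ∀ u → Steps (u ∷ [])
  more : ∀ u v s → (v ≡ u ⊕ south ⊎ v ≡ u ⊕ east) → Steps (v ∷ s) → Steps (u ∷ v ∷ s)

data AllInterior (sh : Shape) : Seg → Set where
  []  : AllInterior sh []
  _∷_ : ∀ {u s} → Interior sh u → AllInterior sh s → AllInterior sh (u ∷ s)

-- s is a segment of λ (Steps forces s to be nonempty, i.e. m ≥ 0).
IsSeg : Shape → Seg → Set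
IsSeg sh s = Steps s × AllInterior sh s

data Last : Seg → Point → Set where
  here  : ∀ u → Last (u ∷ []) u
  there : ∀ u v s w → Last (v ∷ s) w → Last (u ∷ v ∷ s) w

data Head : Seg → Point → Set where
  head : ∀ u s → Head (u ∷ s) u

-- s_term is one unit North or West of t_init; then s ∘ t = s ++ t.
Composable : Seg → Seg → Set
Composable s t = Σ Point λ x → Σ Point λ y →
  Last s x × Head t y × (x ≡ y ⊕ north ⊎ x ≡ y ⊕ west)

_⊑_ : Seg → Seg → Set
s ⊑ t = ∃[ p ] ∃[ q ] (t ≡ p ++ s ++ q)

_⊏_ : Seg → Seg → Set
s ⊏ t = s ⊑ t × s ≢ t

Closed : Shape → (Seg → Set) → Set
Closed sh P = ∀ s t → IsSeg sh s → IsSeg sh t → Composable s t →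
  P s → P t → P (s ++ t)

Biclosed : Shape → (Seg → Set) → Set
Biclosed sh P = (∀ s → P s → IsSeg sh s)
              × Closed sh P
              × Closed sh (λ s → ¬ P s)

data Cl (P : Seg → Set) : Seg → Set where
  base : ∀ {s} → P s → Cl P s
  comp : ∀ {s t} → Composable s t → Cl P s → Cl P t → Cl P (s ++ t)

Bic : Shape → (Seg → Bool) → Set
Bic sh X = Biclosed sh (λ s → T (X s))

SingleStep : Shape → Set
SingleStep sh = ∀ X Y → Bic sh X → Bic sh Y →
  (∀ s → T (X s) → T (Y s)) → (∃[ s ] (T (Y s) × ¬ T (X s))) →
  ∃[ y ] (T (Y y) × ¬ T (X y) × Biclosed sh (λ z → T (X z) ⊎ z ≡ y))

UnionProp : Shape → Set
UnionProp sh = ∀ W X Y → Bic sh W → Bic sh X → Bic sh Y →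
  (∀ s → T (W s) → T (X s) × T (Y s)) →
  Biclosed sh (λ s → T (W s) ⊎ Cl (λ z → (T (X z) ⊎ T (Y z)) × ¬ T (W z)) s)

ProperParts : Shape → Set
ProperParts sh = ∀ s t u → IsSeg sh s → IsSeg sh t → IsSeg sh u →
  Composable s t → s ++ t ≡ u → (s ⊏ u) × (t ⊏ u)

module Submission where

-- Segments are nonempty lists of interior points, and composition is list
-- concatenation, so the argument rests on the combinatorics of cutting a
-- list into two pieces.  The central notion is "u splits over P": every cut
-- of u into two nonempty pieces leaves a piece in P.  Elements of a set with
-- closed complement split over it, and splits-++ propagates splitting to
-- composites; this single lemma drives both (1) and (2).
--
-- (3) is immediate: s ∘ t = s ++ t with s and t nonempty.
-- (2) Z = W ∪ cl((X ∪ Y) \ W) is closed because composing with W stays in Z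
--     (induction on the closure), and coclosed because every element of the
--     closure splits over Z.
-- (1) The potential a − b grows by one along each step, so segments have
--     bounded length and S is finite; minimal and maximal witnesses exist.
--     A shortest element of Y \ X splits over X (a "candidate"); composing a
--     candidate with a shortest defect x ∈ X gives a longer candidate, so a
--     longest candidate y absorbs X on both sides, and X ∪ {y} is biclosed.

open import Defs
open import Data.Integer using (ℤ; 0ℤ; 1ℤ; +_; -_; _+_; _-_; ∣_∣)
import Data.Integer.Properties as Intₚ
open import Data.Integer.Tactic.RingSolver using (solve-∀)
import Data.Nat as Nat
open import Data.Nat using (ℕ; zero; suc; _≤_; _<_; _<?_; _∸_; z≤n; s≤s)
open import Data.Nat.Properties
  using (≮⇒≥; <⇒≱; ∸-monoʳ-<; +-mono-≤; m≤m+n; m≤n⇒m≤o+n; module ≤-Reasoning)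
open import Data.Nat.Induction using (<-wellFounded)
open import Data.Nat.ListAction using (sum)
open import Induction.WellFounded using (Acc; acc)
open import Data.Product using (_×_; _,_; ∃-syntax; proj₁; proj₂; map₁)
open import Data.Product.Properties using (≡-dec)
open import Data.Sum using (_⊎_; inj₁; inj₂)
import Data.Sum as Sum
open import Data.List using (List; []; _∷_; _++_; length; map; cartesianProductWith)
open import Data.List.Properties
  using (∷-injective; ++-assoc; ++-conicalˡ; ++-identityʳ; ++-identityʳ-unique;
         ++-identityˡ-unique; length-++-≤ʳ)
open import Data.List.Membership.Propositional using (_∈_; lose)
open import Data.List.Membership.Propositional.Properties using (∈-cartesianProductWith⁺)
open import Data.List.Relation.Unary.All using (All; []; _∷_)
open import Data.List.Relation.Unary.Any using (here; there; any?; satisfied)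
open import Data.Bool using (Bool; T)
open import Data.Bool.Properties using (T?)
open import Data.Empty using (⊥-elim)
open import Function using (_∘_)
open import Relation.Nullary using (¬_; Dec; yes; no)
open import Relation.Nullary.Decidable
  using (decidable-stable; _⊎-dec_; _×-dec_; _→-dec_; ¬?)
open import Relation.Binary.PropositionalEquality

module _ {A : Set} where

  NonEmpty : List A → Set
  NonEmpty s = s ≢ []

  ∷-nonEmpty : ∀ {u s} → NonEmpty (u ∷ s)
  ∷-nonEmpty ()

  ++-nonEmpty : ∀ s t → NonEmpty s → NonEmpty (s ++ t)
  ++-nonEmpty s t s≢[] = s≢[] ∘ ++-conicalˡ s t

  nonEmpty? : ∀ s → Dec (NonEmpty s)
  nonEmpty? []      = no λ []≢[] → []≢[] refl
  nonEmpty? (_ ∷ _) = yes ∷-nonEmpty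

  prefix-shorter : ∀ s {t} → NonEmpty t → length s < length (s ++ t)
  prefix-shorter []      {[]}    t≢[] = ⊥-elim (t≢[] refl)
  prefix-shorter []      {_ ∷ _} _    = s≤s z≤n
  prefix-shorter (_ ∷ s) t≢[]         = s≤s (prefix-shorter s t≢[])

  suffix-shorter : ∀ s {t} → NonEmpty s → length t < length (s ++ t)
  suffix-shorter []          s≢[] = ⊥-elim (s≢[] refl)
  suffix-shorter (_ ∷ s) {t} _    = s≤s (length-++-≤ʳ t {s})

  data Cut (s t a b : List A) : Set where
    at-boundary  : s ≡ a → t ≡ b → Cut s t a b
    inside-left  : ∀ m → NonEmpty m → a ≡ s ++ m → t ≡ m ++ b → Cut s t a b
    inside-right : ∀ m → NonEmpty m → s ≡ a ++ m → b ≡ m ++ t → Cut s t a b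

  cut : ∀ s t a b → s ++ t ≡ a ++ b → Cut s t a b
  cut []      t []      b t≡b = at-boundary refl t≡b
  cut []      t (x ∷ a) b t≡  = inside-left (x ∷ a) ∷-nonEmpty refl t≡
  cut (x ∷ s) t []      b ≡b  = inside-right (x ∷ s) ∷-nonEmpty refl (sym ≡b)
  cut (x ∷ s) t (y ∷ a) b eq with ∷-injective eq
  ... | refl , eq′ with cut s t a b eq′
  ...   | at-boundary  refl refl        = at-boundary refl refl
  ...   | inside-left  m m≢[] refl refl = inside-left m m≢[] refl refl
  ...   | inside-right m m≢[] refl refl = inside-right m m≢[] refl refl

  all-cuts? : ∀ {Q : List A → List A → Set} → (∀ a b → Dec (Q a b)) →
    ∀ u → Dec (∀ a b → a ++ b ≡ u → Q a b)
  all-cuts? Q? [] with Q? [] []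
  ... | yes q = yes λ { [] [] refl → q }
  ... | no ¬q = no λ cuts → ¬q (cuts [] [] refl)
  all-cuts? {Q} Q? (x ∷ u) with Q? [] (x ∷ u) | all-cuts? (λ a b → Q? (x ∷ a) b) u
  ... | no ¬q | _        = no λ cuts → ¬q (cuts [] (x ∷ u) refl)
  ... | yes _ | no ¬rest = no λ cuts → ¬rest λ a b eq → cuts (x ∷ a) b (cong (x ∷_) eq)
  ... | yes q | yes rest = yes cuts
    where
    cuts : ∀ a b → a ++ b ≡ x ∷ u → Q a b
    cuts []      _ refl = q
    cuts (_ ∷ a) b eq with ∷-injective eq
    ... | refl , eq′ = rest a b eq′

minimise : ∀ {A : Set} (L : List A) (μ : A → ℕ) {P : A → Set} →
  (∀ x → Dec (P x)) → (∀ {x} → P x → x ∈ L) →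
  ∀ {x} → P x → ∃[ m ] (P m × ∀ z → P z → μ m ≤ μ z)
minimise L μ {P} P? P⊆L {x} px = descend x (<-wellFounded (μ x)) px
  where
  descend : ∀ x → Acc _<_ (μ x) → P x → ∃[ m ] (P m × ∀ z → P z → μ m ≤ μ z)
  descend x (acc smaller) px with any? (λ z → P? z ×-dec μ z <? μ x) L
  ... | yes below = let z , pz , z<x = satisfied below in descend z (smaller z<x) pz
  ... | no none   = x , px , λ z pz → ≮⇒≥ (λ z<x → none (lose (P⊆L pz) (pz , z<x)))

maximise : ∀ {A : Set} (L : List A) (μ : A → ℕ) (bound : ℕ) {P : A → Set} →
  (∀ x → Dec (P x)) → (∀ {x} → P x → x ∈ L) → (∀ {x} → P x → μ x ≤ bound) →
  ∀ {x} → P x → ∃[ m ] (P m × ∀ z → P z → μ z ≤ μ m)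
maximise L μ bound P? P⊆L bounded px with minimise L (λ x → bound ∸ μ x) P? P⊆L px
... | m , pm , least =
  m , pm , λ z pz → ≮⇒≥ (λ m<z → <⇒≱ (∸-monoʳ-< m<z (bounded pz)) (least z pz))

words : ∀ {A : Set} → List A → ℕ → List (List A)
words xs zero    = [] ∷ []
words xs (suc n) = [] ∷ cartesianProductWith _∷_ xs (words xs n)

∈-words : ∀ {A : Set} {xs : List A} n {w} → All (_∈ xs) w → length w ≤ n → w ∈ words xs n
∈-words zero    []           _         = here refl
∈-words (suc n) []           _         = here refl
∈-words (suc n) (x∈xs ∷ w∈) (s≤s |w|≤n) =
  there (∈-cartesianProductWith⁺ _∷_ x∈xs (∈-words n w∈ |w|≤n))

≤-sum : ∀ {A : Set} (f : A → ℕ) {x} xs → x ∈ xs → f x ≤ sum (map f xs)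
≤-sum f (x ∷ xs) (here refl) = m≤m+n (f x) _
≤-sum f (y ∷ xs) (there x∈) = m≤n⇒m≤o+n (f y) (≤-sum f xs x∈)

origin : Point
origin = (0ℤ , 0ℤ)

⊕-identityʳ : ∀ p → p ⊕ origin ≡ p
⊕-identityʳ (a , b) = cong₂ _,_ (Intₚ.+-identityʳ a) (Intₚ.+-identityʳ b)

⊕-cancel : ∀ p q r → q ⊕ r ≡ origin → (p ⊕ q) ⊕ r ≡ p
⊕-cancel (a , b) (c , d) (e , f) q⊕r≡0 = begin
  ((a , b) ⊕ (c , d)) ⊕ (e , f) ≡⟨ cong₂ _,_ (Intₚ.+-assoc a c e) (Intₚ.+-assoc b d f) ⟩
  (a , b) ⊕ ((c , d) ⊕ (e , f)) ≡⟨ cong ((a , b) ⊕_) q⊕r≡0 ⟩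
  (a , b) ⊕ origin              ≡⟨ ⊕-identityʳ (a , b) ⟩
  (a , b)                       ∎
  where open ≡-Reasoning

Step : Point → Point → Set
Step u v = v ≡ u ⊕ south ⊎ v ≡ u ⊕ east

NorthWest : Point → Point → Set
NorthWest x y = x ≡ y ⊕ north ⊎ x ≡ y ⊕ west

northWest⇒step : ∀ {x y} → NorthWest x y → Step x y
northWest⇒step {y = y} (inj₁ refl) = inj₁ (sym (⊕-cancel y north south refl))
northWest⇒step {y = y} (inj₂ refl) = inj₂ (sym (⊕-cancel y west east refl))

step⇒northWest : ∀ {x y} → Step x y → NorthWest x y
step⇒northWest {x} (inj₁ refl) = inj₁ (sym (⊕-cancel x south north refl))
step⇒northWest {x} (inj₂ refl) = inj₂ (sym (⊕-cancel x east west refl))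

potential : Point → ℤ
potential (a , b) = a - b

potential-step : ∀ {u v} → Step u v → potential v ≡ potential u + 1ℤ
potential-step {a , b} (inj₁ refl) = south-law a b
  where
  south-law : ∀ a b → (a + 0ℤ) - (b + - 1ℤ) ≡ (a - b) + 1ℤ
  south-law = solve-∀
potential-step {a , b} (inj₂ refl) = east-law a b
  where
  east-law : ∀ a b → (a + 1ℤ) - (b + 0ℤ) ≡ (a - b) + 1ℤ
  east-law = solve-∀

seg-nonEmpty : ∀ {sh s} → IsSeg sh s → NonEmpty s
seg-nonEmpty (one _ , _) ()
seg-nonEmpty (more _ _ _ _ _ , _) ()

lastOf : Point → Seg → Point
lastOf u []      = u
lastOf _ (v ∷ r) = lastOf v r

last-lastOf : ∀ u r → Last (u ∷ r) (lastOf u r)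
last-lastOf u []      = here u
last-lastOf u (v ∷ r) = there u v r _ (last-lastOf v r)

Last⇒lastOf : ∀ {u r x} → Last (u ∷ r) x → x ≡ lastOf u r
Last⇒lastOf (here _)            = refl
Last⇒lastOf (there _ _ _ _ last) = Last⇒lastOf last

steps-++ : ∀ {s t} → Steps s → Steps t → Composable s t → Steps (s ++ t)
steps-++ (one u) steps-t (.u , v , here .u , head .v r , nw) =
  more u v r (northWest⇒step nw) steps-t
steps-++ (more u v s uv steps-s) steps-t (x , y , there .u .v .s .x last , first , nw) =
  more u v (s ++ _) uv (steps-++ steps-s steps-t (x , y , last , first , nw))

steps-split : ∀ s {t} → Steps (s ++ t) → NonEmpty s → NonEmpty t →
  Steps s × Steps t × Composable s t
steps-split []          _ s≢[] _ = ⊥-elim (s≢[] refl)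
steps-split (u ∷ []) {[]} _ _ t≢[] = ⊥-elim (t≢[] refl)
steps-split (u ∷ []) {v ∷ t} (more .u .v .t uv steps-t) _ _ =
  one u , steps-t , u , v , here u , head v t , step⇒northWest uv
steps-split (u ∷ v ∷ s) (more .u .v ._ uv steps) _ t≢[]
  with steps-split (v ∷ s) steps ∷-nonEmpty t≢[]
... | steps-s , steps-t , (x , y , last , first , nw) =
  more u v s uv steps-s , steps-t , x , y , there u v s x last , first , nw

interior-++ : ∀ {sh s t} → AllInterior sh s → AllInterior sh t → AllInterior sh (s ++ t)
interior-++ []         int-t = int-t
interior-++ (i ∷ int-s) int-t = i ∷ interior-++ int-s int-t

interior-split : ∀ {sh} s {t} → AllInterior sh (s ++ t) → AllInterior sh s × AllInterior sh t
interior-split []      int        = [] , int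
interior-split (_ ∷ s) (i ∷ int) = map₁ (i ∷_) (interior-split s int)

seg-++ : ∀ {sh s t} → IsSeg sh s → IsSeg sh t → Composable s t → IsSeg sh (s ++ t)
seg-++ (steps-s , int-s) (steps-t , int-t) st =
  steps-++ steps-s steps-t st , interior-++ int-s int-t

seg-split : ∀ {sh} s {t} → IsSeg sh (s ++ t) → NonEmpty s → NonEmpty t →
  IsSeg sh s × IsSeg sh t × Composable s t
seg-split s (steps , int) s≢[] t≢[] with steps-split s steps s≢[] t≢[] | interior-split s int
... | steps-s , steps-t , st | int-s , int-t = (steps-s , int-s) , (steps-t , int-t) , st

record Split₃ (sh : Shape) (p q r : Seg) : Set where
  field
    p∘q    : Composable p q
    pq∘r   : Composable (p ++ q) r
    p∘qr   : Composable p (q ++ r)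
    q∘r    : Composable q r

seg-split₃ : ∀ {sh} p q r → IsSeg sh (p ++ q ++ r) →
  NonEmpty p → NonEmpty q → NonEmpty r → Split₃ sh p q r
seg-split₃ {sh} p q r seg p≢[] q≢[] r≢[] = record
  { p∘q = proj₂ (proj₂ (seg-split p (proj₁ pq|r) p≢[] q≢[]))
  ; pq∘r = proj₂ (proj₂ pq|r) ; p∘qr = proj₂ (proj₂ p|qr)
  ; q∘r = proj₂ (proj₂ (seg-split q (proj₁ (proj₂ p|qr)) q≢[] r≢[]))
  }
  where
  pq|r : IsSeg sh (p ++ q) × IsSeg sh r × Composable (p ++ q) r
  pq|r = seg-split (p ++ q) (subst (IsSeg sh) (sym (++-assoc p q r)) seg)
                   (++-nonEmpty p q p≢[]) r≢[]
  p|qr : IsSeg sh p × IsSeg sh (q ++ r) × Composable p (q ++ r)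
  p|qr = seg-split p seg p≢[] (++-nonEmpty q r q≢[])

potential-along : ∀ u r → Steps (u ∷ r) → potential (lastOf u r) ≡ potential u + + length r
potential-along u []      _ = sym (Intₚ.+-identityʳ (potential u))
potential-along u (v ∷ r) (more .u .v .r uv steps) = begin
  potential (lastOf v r)          ≡⟨ potential-along v r steps ⟩
  potential v + + length r        ≡⟨ cong (_+ + length r) (potential-step {u} {v} uv) ⟩
  (potential u + 1ℤ) + + length r ≡⟨ Intₚ.+-assoc (potential u) 1ℤ (+ length r) ⟩
  potential u + + suc (length r)  ∎
  where open ≡-Reasoning

-- A segment never composes with itself: that would need the potential at
-- its start to exceed the (larger or equal) potential at its end.
no-self-composition : ∀ {y} → Steps y → ¬ Composable y y
no-self-composition {u ∷ r} steps (x , .u , last , head .u .r , nw) =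
  +suc≢0 (identityʳ-unique (potential u) (+ suc (length r)) (sym around))
  where
  open import Algebra.Properties.AbelianGroup Intₚ.+-0-abelianGroup using (identityʳ-unique)
  open ≡-Reasoning
  +suc≢0 : ∀ {n} → + suc n ≢ 0ℤ
  +suc≢0 ()
  around : potential u ≡ potential u + + suc (length r)
  around = begin
    potential u                     ≡⟨ potential-step {x} {u} (northWest⇒step {x} {u} nw) ⟩
    potential x + 1ℤ                ≡⟨ cong (λ z → potential z + 1ℤ) (Last⇒lastOf last) ⟩
    potential (lastOf u r) + 1ℤ     ≡⟨ cong (_+ 1ℤ) (potential-along u r steps) ⟩
    (potential u + + length r) + 1ℤ ≡⟨ Intₚ.+-assoc (potential u) (+ length r) 1ℤ ⟩
    potential u + (+ length r + 1ℤ) ≡⟨ cong (_+_ (potential u)) (Intₚ.+-comm (+ length r) 1ℤ) ⟩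
    potential u + + suc (length r)  ∎

interior-in-shape : ∀ {sh v} → Interior sh v → v ∈ sh
interior-in-shape {sh} {v} int =
  subst (_∈ sh) (⊕-identityʳ v) (int 0ℤ 0ℤ (there (here refl)) (there (here refl)))

points-in-shape : ∀ {sh s} → AllInterior sh s → All (_∈ sh) s
points-in-shape []          = []
points-in-shape (i ∷ int) = interior-in-shape i ∷ points-in-shape int

last-interior : ∀ {sh u r} → AllInterior sh (u ∷ r) → Interior sh (lastOf u r)
last-interior (i ∷ [])          = i
last-interior (_ ∷ int@(_ ∷ _)) = last-interior int

-- A shape has only finitely many segments: the potential increases along a
-- segment and is bounded on the shape, so segments have bounded length and
-- are among the words of bounded length over the vertices.
module Finite (sh : Shape) where

  potentialBound : ℕ
  potentialBound = sum (map (∣_∣ ∘ potential) sh)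

  maxLength : ℕ
  maxLength = suc (potentialBound Nat.+ potentialBound)

  length≤maxLength : ∀ {s} → IsSeg sh s → length s ≤ maxLength
  length≤maxLength {u ∷ r} (steps , int@(i ∷ _)) = s≤s (begin
    length r                                ≡⟨ cong ∣_∣ rise ⟩
    ∣ potential (lastOf u r) - potential u ∣
      ≤⟨ Intₚ.∣i-j∣≤∣i∣+∣j∣ (potential (lastOf u r)) (potential u) ⟩
    ∣ potential (lastOf u r) ∣ Nat.+ ∣ potential u ∣
      ≤⟨ +-mono-≤ (bounded {lastOf u r} (last-interior int)) (bounded {u} i) ⟩
    potentialBound Nat.+ potentialBound     ∎)
    where
    open ≤-Reasoning
    cancel : ∀ a b → b ≡ (a + b) - a
    cancel = solve-∀
    rise : + length r ≡ potential (lastOf u r) - potential u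
    rise = trans (cancel (potential u) (+ length r))
                 (cong (_- potential u) (sym (potential-along u r steps)))
    bounded : ∀ {v} → Interior sh v → ∣ potential v ∣ ≤ potentialBound
    bounded {v} = ≤-sum (∣_∣ ∘ potential) {v} sh ∘ interior-in-shape

  segments : List Seg
  segments = words sh maxLength

  seg∈segments : ∀ {s} → IsSeg sh s → s ∈ segments
  seg∈segments seg@(_ , int) = ∈-words maxLength (points-in-shape int) (length≤maxLength seg)

infix 4 _≟ₚ_
_≟ₚ_ : (p q : Point) → Dec (p ≡ q)
_≟ₚ_ = ≡-dec Intₚ._≟_ Intₚ._≟_

composable? : ∀ s t → Dec (Composable s t)
composable? []      t       = no λ { (_ , _ , () , _) }
composable? (u ∷ r) []      = no λ { (_ , _ , _ , () , _) }
composable? (u ∷ r) (v ∷ t) with (lastOf u r ≟ₚ v ⊕ north) ⊎-dec (lastOf u r ≟ₚ v ⊕ west)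
... | yes nw = yes (lastOf u r , v , last-lastOf u r , head v t , nw)
... | no ¬nw = no λ { (x , .v , last , head .v .t , nw) →
                        ¬nw (subst (λ z → NorthWest z v) (Last⇒lastOf last) nw) }

-- u splits over P when every cut of u into two nonempty pieces leaves a
-- piece in P: the coclosedness condition for P, read at the single element u.
Splits : (Seg → Set) → Seg → Set
Splits P u = ∀ s t → s ++ t ≡ u → NonEmpty s → NonEmpty t → P s ⊎ P t

splits-mono : ∀ {P Q : Seg → Set} {u} → (∀ {s} → P s → Q s) → Splits P u → Splits Q u
splits-mono P⊆Q split-u s t eq s≢[] t≢[] = Sum.map P⊆Q P⊆Q (split-u s t eq s≢[] t≢[])

splits-++ : ∀ {P : Seg → Set} a b → Splits P a → Splits P b → P a ⊎ P b →
  (∀ s m → NonEmpty s → NonEmpty m → a ≡ s ++ m → P m → P (m ++ b)) →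
  (∀ m t → NonEmpty m → NonEmpty t → b ≡ m ++ t → P m → P (a ++ m)) →
  Splits P (a ++ b)
splits-++ a b split-a split-b a⊎b attach-b attach-a s t eq s≢[] t≢[] with cut s t a b eq
... | at-boundary  refl refl        = a⊎b
... | inside-left  m m≢[] refl refl =
  Sum.map₂ (attach-b s m s≢[] m≢[] refl) (split-a s m refl s≢[] m≢[])
... | inside-right m m≢[] refl refl =
  Sum.map₁ (attach-a m t m≢[] t≢[] refl) (split-b m t refl m≢[] t≢[])

splits? : ∀ {P : Seg → Set} → (∀ s → Dec (P s)) → ∀ u → Dec (Splits P u)
splits? P? = all-cuts? λ s t → nonEmpty? s →-dec nonEmpty? t →-dec (P? s ⊎-dec P? t)

bic-seg : ∀ {sh P} → Biclosed sh P → ∀ {s} → P s → IsSeg sh s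
bic-seg (⊆seg , _) = ⊆seg _

bic-closed : ∀ {sh P} → Biclosed sh P → Closed sh P
bic-closed (_ , closed , _) = closed

bic-coclosed : ∀ {sh P} → Biclosed sh P → Closed sh (λ s → ¬ P s)
bic-coclosed (_ , _ , coclosed) = coclosed

closed-join : ∀ {sh P} → Closed sh P → ∀ s t → IsSeg sh (s ++ t) →
  NonEmpty s → NonEmpty t → P s → P t → P (s ++ t)
closed-join closed s t seg-st s≢[] t≢[] with seg-split s seg-st s≢[] t≢[]
... | seg-s , seg-t , st = closed s t seg-s seg-t st

coclosed-splits : ∀ {sh P} → (∀ s → Dec (P s)) → Closed sh (λ s → ¬ P s) →
  ∀ {u} → IsSeg sh u → P u → Splits P u
coclosed-splits P? coclosed seg-u pu s t refl s≢[] t≢[] =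
  decidable-stable (P? s ⊎-dec P? t) λ neither →
    closed-join coclosed s t seg-u s≢[] t≢[] (neither ∘ inj₁) (neither ∘ inj₂) pu

⟦_⟧ : (Seg → Bool) → Seg → Set
⟦ X ⟧ s = T (X s)

⟦_⟧? : ∀ X s → Dec (⟦ X ⟧ s)
⟦ X ⟧? s = T? (X s)

properParts : ∀ sh → ProperParts sh
properParts sh s t _ seg-s seg-t _ _ refl =
  (([] , t , refl) , λ s≡s++t → seg-nonEmpty seg-t (++-identityʳ-unique s s≡s++t)) ,
  ((s , [] , cong (s ++_) (sym (++-identityʳ t))) ,
   λ t≡s++t → seg-nonEmpty seg-s (++-identityˡ-unique s t≡s++t))

module UnionClosure (sh : Shape) (W X Y : Seg → Bool)
    (bic-W : Bic sh W) (bic-X : Bic sh X) (bic-Y : Bic sh Y)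
    (W⊆X∩Y : ∀ s → ⟦ W ⟧ s → ⟦ X ⟧ s × ⟦ Y ⟧ s) where

  X∪Y : Seg → Set
  X∪Y s = ⟦ X ⟧ s ⊎ ⟦ Y ⟧ s

  Gen : Seg → Set
  Gen s = X∪Y s × ¬ ⟦ W ⟧ s

  C : Seg → Set
  C = Cl Gen

  Z : Seg → Set
  Z s = ⟦ W ⟧ s ⊎ C s

  X∪Y-seg : ∀ {s} → X∪Y s → IsSeg sh s
  X∪Y-seg (inj₁ xs) = bic-seg bic-X xs
  X∪Y-seg (inj₂ ys) = bic-seg bic-Y ys

  C-seg : ∀ {s} → C s → IsSeg sh s
  C-seg (base (xy , _))  = X∪Y-seg xy
  C-seg (comp st cs ct) = seg-++ (C-seg cs) (C-seg ct) st

  Z-seg : ∀ {s} → Z s → IsSeg sh s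
  Z-seg (inj₁ ws) = bic-seg bic-W ws
  Z-seg (inj₂ cs) = C-seg cs

  X∪Y⊆Z : ∀ {s} → X∪Y s → Z s
  X∪Y⊆Z {s} xy with ⟦ W ⟧? s
  ... | yes ws = inj₁ ws
  ... | no ¬ws = inj₂ (base (xy , ¬ws))

  W∘X∪Y : ∀ {s t} → ⟦ W ⟧ s → X∪Y t → Composable s t → X∪Y (s ++ t)
  W∘X∪Y {s} {t} ws (inj₁ xt) st =
    inj₁ (bic-closed bic-X s t (bic-seg bic-W ws) (bic-seg bic-X xt) st (proj₁ (W⊆X∩Y s ws)) xt)
  W∘X∪Y {s} {t} ws (inj₂ yt) st =
    inj₂ (bic-closed bic-Y s t (bic-seg bic-W ws) (bic-seg bic-Y yt) st (proj₂ (W⊆X∩Y s ws)) yt)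

  X∪Y∘W : ∀ {s t} → X∪Y s → ⟦ W ⟧ t → Composable s t → X∪Y (s ++ t)
  X∪Y∘W {s} {t} (inj₁ xs) wt st =
    inj₁ (bic-closed bic-X s t (bic-seg bic-X xs) (bic-seg bic-W wt) st xs (proj₁ (W⊆X∩Y t wt)))
  X∪Y∘W {s} {t} (inj₂ ys) wt st =
    inj₂ (bic-closed bic-Y s t (bic-seg bic-Y ys) (bic-seg bic-W wt) st ys (proj₂ (W⊆X∩Y t wt)))

  -- Composing an element of C with an element of W lands in Z, by induction
  -- over the generation of C: s ∘ (a ∘ b) = (s ∘ a) ∘ b, where s ∘ a ∈ Z.
  W∘C : ∀ {s t} → ⟦ W ⟧ s → C t → Composable s t → Z (s ++ t)
  W∘C ws (base (xy , _)) st = X∪Y⊆Z (W∘X∪Y ws xy st)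
  W∘C {s} ws (comp {a} {b} ab ca cb) s∘ab =
    subst Z (++-assoc s a b) (attach-b (W∘C ws ca p∘q))
    where
    open Split₃ (seg-split₃ s a b (seg-++ (bic-seg bic-W ws) (C-seg (comp ab ca cb)) s∘ab)
                  (seg-nonEmpty (bic-seg bic-W ws)) (seg-nonEmpty (C-seg ca)) (seg-nonEmpty (C-seg cb)))
    attach-b : Z (s ++ a) → Z ((s ++ a) ++ b)
    attach-b (inj₁ wsa) = W∘C wsa cb pq∘r
    attach-b (inj₂ csa) = inj₂ (comp pq∘r csa cb)

  C∘W : ∀ {s t} → C s → ⟦ W ⟧ t → Composable s t → Z (s ++ t)
  C∘W (base (xy , _)) wt st = X∪Y⊆Z (X∪Y∘W xy wt st)
  C∘W {t = t} (comp {a} {b} ab ca cb) wt ab∘t =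
    subst Z (sym (++-assoc a b t)) (attach-a (C∘W cb wt q∘r))
    where
    open Split₃ (seg-split₃ a b t (subst (IsSeg sh) (++-assoc a b t)
                                     (seg-++ (C-seg (comp ab ca cb)) (bic-seg bic-W wt) ab∘t))
                  (seg-nonEmpty (C-seg ca)) (seg-nonEmpty (C-seg cb)) (seg-nonEmpty (bic-seg bic-W wt)))
    attach-a : Z (b ++ t) → Z (a ++ b ++ t)
    attach-a (inj₁ wbt) = C∘W ca wbt p∘qr
    attach-a (inj₂ cbt) = inj₂ (comp p∘qr ca cbt)

  Z-closed : Closed sh Z
  Z-closed s t seg-s seg-t st (inj₁ ws) (inj₁ wt) = inj₁ (bic-closed bic-W s t seg-s seg-t st ws wt)
  Z-closed s t seg-s seg-t st (inj₁ ws) (inj₂ ct) = W∘C ws ct st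
  Z-closed s t seg-s seg-t st (inj₂ cs) (inj₁ wt) = C∘W cs wt st
  Z-closed s t seg-s seg-t st (inj₂ cs) (inj₂ ct) = inj₂ (comp st cs ct)

  -- Every element of C splits over Z: generators split over X or Y (which
  -- are coclosed), and a composite a ∘ b splits by splits-++, since Z is closed.
  C-splits : ∀ {u} → C u → Splits Z u
  C-splits (base (inj₁ xu , _)) =
    splits-mono (X∪Y⊆Z ∘ inj₁)
      (coclosed-splits ⟦ X ⟧? (bic-coclosed bic-X) (bic-seg bic-X xu) xu)
  C-splits (base (inj₂ yu , _)) =
    splits-mono (X∪Y⊆Z ∘ inj₂)
      (coclosed-splits ⟦ Y ⟧? (bic-coclosed bic-Y) (bic-seg bic-Y yu) yu)
  C-splits (comp {a} {b} ab ca cb) =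
    splits-++ a b (C-splits ca) (C-splits cb) (inj₁ (inj₂ ca)) attach-b attach-a
    where
    seg-ab : IsSeg sh (a ++ b)
    seg-ab = C-seg (comp ab ca cb)
    attach-b : ∀ s m → NonEmpty s → NonEmpty m → a ≡ s ++ m → Z m → Z (m ++ b)
    attach-b s m s≢[] m≢[] refl zm =
      Z-closed m b (Z-seg zm) (C-seg cb) q∘r zm (inj₂ cb)
      where open Split₃ (seg-split₃ s m b (subst (IsSeg sh) (++-assoc s m b) seg-ab)
                           s≢[] m≢[] (seg-nonEmpty (C-seg cb)))
    attach-a : ∀ m t → NonEmpty m → NonEmpty t → b ≡ m ++ t → Z m → Z (a ++ m)
    attach-a m t m≢[] t≢[] refl zm =
      Z-closed a m (C-seg ca) (Z-seg zm) p∘q (inj₂ ca) zm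
      where open Split₃ (seg-split₃ a m t seg-ab (seg-nonEmpty (C-seg ca)) m≢[] t≢[])

  Z-coclosed : Closed sh (λ s → ¬ Z s)
  Z-coclosed s t seg-s seg-t st ¬zs ¬zt (inj₁ wst) =
    bic-coclosed bic-W s t seg-s seg-t st (¬zs ∘ inj₁) (¬zt ∘ inj₁) wst
  Z-coclosed s t seg-s seg-t st ¬zs ¬zt (inj₂ cst) =
    Sum.[ ¬zs , ¬zt ] (C-splits cst s t refl (seg-nonEmpty seg-s) (seg-nonEmpty seg-t))

  Z-biclosed : Biclosed sh Z
  Z-biclosed = (λ _ → Z-seg) , Z-closed , Z-coclosed

unionProp : ∀ sh → UnionProp sh
unionProp sh W X Y bic-W bic-X bic-Y W⊆X∩Y =
  UnionClosure.Z-biclosed sh W X Y bic-W bic-X bic-Y W⊆X∩Y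

module SingleStepExtension (sh : Shape) (X Y : Seg → Bool)
    (bic-X : Bic sh X) (bic-Y : Bic sh Y) (X⊆Y : ∀ s → ⟦ X ⟧ s → ⟦ Y ⟧ s) where
  open Finite sh

  X-seg : ∀ {s} → ⟦ X ⟧ s → IsSeg sh s
  X-seg = bic-seg bic-X

  X-splits : ∀ {s} → ⟦ X ⟧ s → Splits ⟦ X ⟧ s
  X-splits xs = coclosed-splits ⟦ X ⟧? (bic-coclosed bic-X) (X-seg xs) xs

  -- Candidates for the new element: elements of Y \ X splitting over X
  -- (the latter makes the complement of X ∪ {y} closed).
  Candidate : Seg → Set
  Candidate y = ⟦ Y ⟧ y × ¬ ⟦ X ⟧ y × Splits ⟦ X ⟧ y

  candidate? : ∀ y → Dec (Candidate y)
  candidate? y = ⟦ Y ⟧? y ×-dec ¬? (⟦ X ⟧? y) ×-dec splits? ⟦ X ⟧? y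

  candidate-seg : ∀ {y} → Candidate y → IsSeg sh y
  candidate-seg (yy , _) = bic-seg bic-Y yy

  -- A shortest element of Y \ X is a candidate: cutting it into two pieces
  -- outside X would, Y being coclosed, leave a shorter piece in Y \ X.
  shortest-candidate : ∀ {y} → ⟦ Y ⟧ y → ¬ ⟦ X ⟧ y →
    (∀ z → ⟦ Y ⟧ z × ¬ ⟦ X ⟧ z → length y ≤ length z) → Candidate y
  shortest-candidate {y} yy ¬xy shortest = yy , ¬xy , split-y
    where
    split-y : Splits ⟦ X ⟧ y
    split-y s t refl s≢[] t≢[] = decidable-stable (⟦ X ⟧? s ⊎-dec ⟦ X ⟧? t) λ neither →
      Sum.[ (λ ys → <⇒≱ (prefix-shorter s t≢[]) (shortest s (ys , neither ∘ inj₁)))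
          , (λ yt → <⇒≱ (suffix-shorter s s≢[]) (shortest t (yt , neither ∘ inj₂))) ]
          (coclosed-splits ⟦ Y ⟧? (bic-coclosed bic-Y) (bic-seg bic-Y yy) yy s t refl s≢[] t≢[])

  -- An element x of X composable with y whose composite leaves X: the
  -- obstructions to closedness of X ∪ {y}, on either side of y.
  RightDefect : Seg → Seg → Set
  RightDefect y x = ⟦ X ⟧ x × Composable y x × ¬ ⟦ X ⟧ (y ++ x)

  LeftDefect : Seg → Seg → Set
  LeftDefect y x = ⟦ X ⟧ x × Composable x y × ¬ ⟦ X ⟧ (x ++ y)

  -- Composing a candidate with a shortest defect gives a longer candidate.
  -- Cuts inside y are handled by y splitting and X being closed; cuts
  -- inside x by x splitting and the minimality of x.
  extend-right : ∀ {y x} → Candidate y → RightDefect y x →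
    (∀ z → RightDefect y z → length x ≤ length z) → Candidate (y ++ x)
  extend-right {y} {x} cand@(yy , _ , split-y) (xx , y∘x , ¬xyx) shortest =
    bic-closed bic-Y y x (candidate-seg cand) (X-seg xx) y∘x yy (X⊆Y x xx) , ¬xyx ,
    splits-++ y x split-y (X-splits xx) (inj₂ xx) attach-x attach-y
    where
    seg-yx : IsSeg sh (y ++ x)
    seg-yx = seg-++ (candidate-seg cand) (X-seg xx) y∘x
    attach-x : ∀ s m → NonEmpty s → NonEmpty m → y ≡ s ++ m → ⟦ X ⟧ m → ⟦ X ⟧ (m ++ x)
    attach-x s m s≢[] m≢[] refl xm = bic-closed bic-X m x (X-seg xm) (X-seg xx) q∘r xm xx
      where open Split₃ (seg-split₃ s m x (subst (IsSeg sh) (++-assoc s m x) seg-yx)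
                           s≢[] m≢[] (seg-nonEmpty (X-seg xx)))
    attach-y : ∀ m t → NonEmpty m → NonEmpty t → x ≡ m ++ t → ⟦ X ⟧ m → ⟦ X ⟧ (y ++ m)
    attach-y m t m≢[] t≢[] refl xm = decidable-stable (⟦ X ⟧? (y ++ m)) λ ¬xym →
      <⇒≱ (prefix-shorter m t≢[]) (shortest m (xm , p∘q , ¬xym))
      where open Split₃ (seg-split₃ y m t seg-yx (seg-nonEmpty (candidate-seg cand)) m≢[] t≢[])

  extend-left : ∀ {y x} → Candidate y → LeftDefect y x →
    (∀ z → LeftDefect y z → length x ≤ length z) → Candidate (x ++ y)
  extend-left {y} {x} cand@(yy , _ , split-y) (xx , x∘y , ¬xxy) shortest =
    bic-closed bic-Y x y (X-seg xx) (candidate-seg cand) x∘y (X⊆Y x xx) yy , ¬xxy ,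
    splits-++ x y (X-splits xx) split-y (inj₁ xx) attach-y attach-x
    where
    seg-xy : IsSeg sh (x ++ y)
    seg-xy = seg-++ (X-seg xx) (candidate-seg cand) x∘y
    attach-y : ∀ s m → NonEmpty s → NonEmpty m → x ≡ s ++ m → ⟦ X ⟧ m → ⟦ X ⟧ (m ++ y)
    attach-y s m s≢[] m≢[] refl xm = decidable-stable (⟦ X ⟧? (m ++ y)) λ ¬xmy →
      <⇒≱ (suffix-shorter s s≢[]) (shortest m (xm , q∘r , ¬xmy))
      where open Split₃ (seg-split₃ s m y (subst (IsSeg sh) (++-assoc s m y) seg-xy)
                           s≢[] m≢[] (seg-nonEmpty (candidate-seg cand)))
    attach-x : ∀ m t → NonEmpty m → NonEmpty t → y ≡ m ++ t → ⟦ X ⟧ m → ⟦ X ⟧ (x ++ m)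
    attach-x m t m≢[] t≢[] refl xm = bic-closed bic-X x m (X-seg xx) (X-seg xm) p∘q xx xm
      where open Split₃ (seg-split₃ x m t seg-xy (seg-nonEmpty (X-seg xx)) m≢[] t≢[])

  -- A longest candidate y absorbs X on both sides: a defect would give, via a
  -- shortest defect and extend-right/left, a strictly longer candidate.
  module LongestCandidate {y} (cand : Candidate y)
      (longest : ∀ z → Candidate z → length z ≤ length y) where

    absorbs-right : ∀ {x} → ⟦ X ⟧ x → Composable y x → ⟦ X ⟧ (y ++ x)
    absorbs-right xx y∘x = decidable-stable (⟦ X ⟧? (y ++ _)) λ ¬xyx →
      let x′ , defect , shortest = minimise segments length right-defect?
                                     (seg∈segments ∘ X-seg ∘ proj₁) (xx , y∘x , ¬xyx)
      in <⇒≱ (prefix-shorter y (seg-nonEmpty (X-seg (proj₁ defect))))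
             (longest (y ++ x′) (extend-right cand defect shortest))
      where
      right-defect? : ∀ z → Dec (RightDefect y z)
      right-defect? z = ⟦ X ⟧? z ×-dec composable? y z ×-dec ¬? (⟦ X ⟧? (y ++ z))

    absorbs-left : ∀ {x} → ⟦ X ⟧ x → Composable x y → ⟦ X ⟧ (x ++ y)
    absorbs-left xx x∘y = decidable-stable (⟦ X ⟧? (_ ++ y)) λ ¬xxy →
      let x′ , defect , shortest = minimise segments length left-defect?
                                     (seg∈segments ∘ X-seg ∘ proj₁) (xx , x∘y , ¬xxy)
      in <⇒≱ (suffix-shorter x′ (seg-nonEmpty (X-seg (proj₁ defect))))
             (longest (x′ ++ y) (extend-left cand defect shortest))
      where
      left-defect? : ∀ z → Dec (LeftDefect y z)
      left-defect? z = ⟦ X ⟧? z ×-dec composable? z y ×-dec ¬? (⟦ X ⟧? (z ++ y))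

    -- X ∪ {y} is closed since y absorbs X on both sides and does not compose
    -- with itself, and coclosed since X is and y splits over X.
    adjoin-biclosed : Biclosed sh (λ z → ⟦ X ⟧ z ⊎ z ≡ y)
    adjoin-biclosed = ⊆seg , closed , coclosed
      where
      ⊆seg : ∀ s → ⟦ X ⟧ s ⊎ s ≡ y → IsSeg sh s
      ⊆seg _ (inj₁ xs)   = X-seg xs
      ⊆seg _ (inj₂ refl) = candidate-seg cand
      closed : Closed sh (λ z → ⟦ X ⟧ z ⊎ z ≡ y)
      closed s t seg-s seg-t st (inj₁ xs) (inj₁ xt) =
        inj₁ (bic-closed bic-X s t seg-s seg-t st xs xt)
      closed _ _ _ _ st (inj₁ xs)   (inj₂ refl) = inj₁ (absorbs-left xs st)
      closed _ _ _ _ st (inj₂ refl) (inj₁ xt)   = inj₁ (absorbs-right xt st)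
      closed _ _ seg-s _ st (inj₂ refl) (inj₂ refl) =
        ⊥-elim (no-self-composition (proj₁ seg-s) st)
      coclosed : Closed sh (λ z → ¬ (⟦ X ⟧ z ⊎ z ≡ y))
      coclosed s t seg-s seg-t st ¬s ¬t (inj₁ xst) =
        bic-coclosed bic-X s t seg-s seg-t st (¬s ∘ inj₁) (¬t ∘ inj₁) xst
      coclosed s t seg-s seg-t st ¬s ¬t (inj₂ st≡y) =
        Sum.[ ¬s ∘ inj₁ , ¬t ∘ inj₁ ]
          (proj₂ (proj₂ cand) s t st≡y (seg-nonEmpty seg-s) (seg-nonEmpty seg-t))

  single-step : ∀ {s₀} → ⟦ Y ⟧ s₀ → ¬ ⟦ X ⟧ s₀ →
    ∃[ y ] (⟦ Y ⟧ y × ¬ ⟦ X ⟧ y × Biclosed sh (λ z → ⟦ X ⟧ z ⊎ z ≡ y))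
  single-step ys₀ ¬xs₀
    with minimise segments length (λ z → ⟦ Y ⟧? z ×-dec ¬? (⟦ X ⟧? z))
                  (seg∈segments ∘ bic-seg bic-Y ∘ proj₁) (ys₀ , ¬xs₀)
  ... | y₀ , (yy₀ , ¬xy₀) , shortest
    with maximise segments length maxLength candidate? (seg∈segments ∘ candidate-seg)
                  (length≤maxLength ∘ candidate-seg) (shortest-candidate yy₀ ¬xy₀ shortest)
  ... | y , cand@(yy , ¬xy , _) , longest =
    y , yy , ¬xy , LongestCandidate.adjoin-biclosed cand longest

singleStep : ∀ sh → SingleStep sh
singleStep sh X Y bic-X bic-Y X⊆Y (_ , ys₀ , ¬xs₀) =
  SingleStepExtension.single-step sh X Y bic-X bic-Y X⊆Y ys₀ ¬xs₀

theorem6p5 : (sh : Shape) → SingleStep sh × UnionProp sh × ProperParts sh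
theorem6p5 sh = singleStep sh , unionProp sh , properParts sh
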